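{- Let $G$ be a finite graph with maximum degree $d$, let $e\in E(G)$, and let $M$ be a matching of $G$ chosen uniformly at random among all matchings of $G$ (including the empty matching). Then \[\mathbb P(e\in M)\ge\frac{1}{d^2+1}.\] -}

module Defs where

open import Data.Bool using (Bool; true; false; _∧_; _∨_; not; if_then_else_)
open import Data.Bool.Properties using () renaming (_≟_ to _≟ᵇ_)
open import Data.Nat using (ℕ; _⊔_; _<ᵇ_)
open import Data.Fin using (Fin; toℕ; _≟_)
open import Data.List using (List; []; _∷_; map; filter; length; foldr; allFin; concatMap; _++_)
open import Data.Bool.ListAction using (all; any)
open import Data.Product using (_×_; _,_; proj₁; proj₂)
open import Relation.Nullary.Decidable using (⌊_⌋)
open import Relation.Binary.PropositionalEquality using (_≡_)
open import Relation.Unary using (Decidable)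

record Graph (n : ℕ) : Set where
  field
    adj     : Fin n → Fin n → Bool
    sym     : ∀ u v → adj u v ≡ adj v u
    irrefl  : ∀ v → adj v v ≡ false
open Graph public

_==_ : ∀ {n} → Fin n → Fin n → Bool
a == b = ⌊ a ≟ b ⌋

degree : ∀ {n} → Graph n → Fin n → ℕ
degree {n} G v = length (filter (λ w → adj G v w ≟ᵇ true) (allFin n))

maxDegree : ∀ {n} → Graph n → ℕ
maxDegree {n} G = foldr _⊔_ 0 (map (degree G) (allFin n))

edges : ∀ {n} → Graph n → List (Fin n × Fin n)
edges {n} G =
  concatMap (λ a → concatMap (λ b →
    if (toℕ a <ᵇ toℕ b) ∧ adj G a b then (a , b) ∷ [] else []) (allFin n)) (allFin n)

-- all sublists (= all subsets of a duplicate-free list), each exactly once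
sublists : ∀ {A : Set} → List A → List (List A)
sublists []       = [] ∷ []
sublists (x ∷ xs) = let r = sublists xs in r ++ map (x ∷_) r

meets : ∀ {n} → Fin n × Fin n → Fin n × Fin n → Bool
meets (a , b) (c , d) = (a == c) ∨ (a == d) ∨ (b == c) ∨ (b == d)

isMatching : ∀ {n} → List (Fin n × Fin n) → Bool
isMatching []       = true
isMatching (x ∷ xs) = all (λ y → not (meets x y)) xs ∧ isMatching xs

matchings : ∀ {n} → Graph n → List (List (Fin n × Fin n))
matchings G = filter (λ M → isMatching M ≟ᵇ true) (sublists (edges G))

containsEdge : ∀ {n} → Fin n → Fin n → List (Fin n × Fin n) → Bool
containsEdge u v M = any (λ { (a , b) → ((a == u) ∧ (b == v)) ∨ ((a == v) ∧ (b == u)) }) M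

-- Let K be the number of matchings of G − u − v. Adding uv maps them injectively to matchings
-- containing uv, so it suffices to show that G has at most (d² + 1) K matchings. A matching
-- either leaves a given vertex w uncovered or contains exactly one edge at w, and removing that
-- edge leaves a matching that avoids its endpoints. Splitting at v shows that the matchings
-- avoiding a vertex set containing u number at most (1 + b) K, where b counts the edges at v
-- other than uv. Splitting then at u bounds all matchings by (1 + b) K (u uncovered), plus K
-- (through uv), plus a (1 + b) K (through the a other edges at u); and a, b ≤ d − 1 gives
-- (1 + a)(1 + b) + 1 ≤ d² + 1.

module Submission where

open import Defs hiding (sym)
open import Data.Bool using (Bool; true; false; _∧_; _∨_; not; if_then_else_)
open import Data.Bool.ListAction using (all; and)
open import Data.Bool.Properties
  using (∧-identityʳ; ∧-assoc; ∧-comm; ∨-comm; ∨-zeroʳ; ∧-conicalˡ; ∧-conicalʳ; ∨-conicalˡ; ∨-conicalʳ; T-≡; ∨-∧-booleanAlgebra)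
  renaming (_≟_ to _≟ᵇ_)
open import Data.Bool.Solver using (module ∨-∧-Solver)
open import Algebra.Lattice.Properties.BooleanAlgebra ∨-∧-booleanAlgebra using (deMorgan₂)
open import Data.Fin using (Fin; zero; suc; toℕ; _≟_)
open import Data.Fin.Properties using (toℕ-injective)
open import Data.List using (List; []; _∷_; length; filter; map; _++_; concatMap; tabulate; allFin; foldr)
open import Data.List.Membership.Propositional using (_∈_)
open import Data.List.Membership.Propositional.Properties using (∈-map⁺; ∈-allFin)
open import Data.List.Properties using (map-cong)
open import Data.List.Relation.Unary.Any using (Any; here; there)
open import Data.List.Relation.Unary.Any.Properties using (concatMap⁺; tabulate⁺)
open import Data.Nat using (ℕ; zero; suc; _≤_; _<_; _*_; _+_; _⊔_; _<ᵇ_; z≤n; s≤s)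
open import Data.Nat.ListAction using (sum)
open import Data.Nat.Tactic.RingSolver using (solve-∀)
open import Data.Nat.Properties hiding (_≟_)
open import Algebra.Properties.CommutativeMonoid.Sum +-0-commutativeMonoid
  using (sum-syntax; ∑-comm; ∑-distrib-+; sum-cong-≗; sum-replicate-zero)
open import Algebra.Properties.CommutativeSemigroup +-commutativeSemigroup
  using () renaming (interchange to +-interchange)
open import Data.Product using (_×_; _,_; proj₁; proj₂)
open import Data.Sum using (_⊎_; inj₁; inj₂)
open import Function using (_∘_; id)
open import Function.Bundles using (Equivalence)
open import Relation.Binary.PropositionalEquality
open import Relation.Binary.Definitions using (tri<; tri≈; tri>)
open import Relation.Nullary.Decidable using (yes; no; isYes≗does; dec-true; dec-false)

private variable
  n : ℕ
  A B : Set

𝟙 : Bool → ℕ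
𝟙 b = if b then 1 else 0

count : (A → Bool) → List A → ℕ
count p xs = length (filter (λ x → p x ≟ᵇ true) xs)

count-∷ : (p : A → Bool) (x : A) (xs : List A) → count p (x ∷ xs) ≡ 𝟙 (p x) + count p xs
count-∷ p x xs with p x
... | true  = refl
... | false = refl

count-++ : (p : A → Bool) (xs ys : List A) → count p (xs ++ ys) ≡ count p xs + count p ys
count-++ p []       ys = refl
count-++ p (x ∷ xs) ys with p x
... | true  = cong suc (count-++ p xs ys)
... | false = count-++ p xs ys

count-map : (p : B → Bool) (f : A → B) (xs : List A) → count p (map f xs) ≡ count (p ∘ f) xs
count-map p f []       = refl
count-map p f (x ∷ xs) with p (f x)
... | true  = cong suc (count-map p f xs)
... | false = count-map p f xs

count-cong : {p q : A → Bool} → (∀ x → p x ≡ q x) → (xs : List A) → count p xs ≡ count q xs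
count-cong p≗q []       = refl
count-cong {p = p} {q} p≗q (x ∷ xs) = begin
  count p (x ∷ xs)         ≡⟨ count-∷ p x xs ⟩
  𝟙 (p x) + count p xs     ≡⟨ cong₂ _+_ (cong 𝟙 (p≗q x)) (count-cong p≗q xs) ⟩
  𝟙 (q x) + count q xs     ≡⟨ count-∷ q x xs ⟨
  count q (x ∷ xs)         ∎
  where open ≡-Reasoning

𝟙-mono : {p q : Bool} → (p ≡ true → q ≡ true) → 𝟙 p ≤ 𝟙 q
𝟙-mono {false} p⇒q = z≤n
𝟙-mono {true}  p⇒q rewrite p⇒q refl = ≤-refl

count-mono : {p q : A → Bool} → (∀ x → p x ≡ true → q x ≡ true) → (xs : List A) → count p xs ≤ count q xs
count-mono p⇒q []       = z≤n
count-mono {p = p} {q} p⇒q (x ∷ xs) = begin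
  count p (x ∷ xs)       ≡⟨ count-∷ p x xs ⟩
  𝟙 (p x) + count p xs   ≤⟨ +-mono-≤ (𝟙-mono (p⇒q x)) (count-mono p⇒q xs) ⟩
  𝟙 (q x) + count q xs   ≡⟨ count-∷ q x xs ⟨
  count q (x ∷ xs)       ∎
  where open ≤-Reasoning

count-∧ˡ : (b : Bool) (q : A → Bool) (xs : List A) → count (λ x → b ∧ q x) xs ≡ (if b then count q xs else 0)
count-∧ˡ true  q xs       = refl
count-∧ˡ false q []       = refl
count-∧ˡ false q (x ∷ xs) = count-∧ˡ false q xs

count-filter : (p q : A → Bool) (xs : List A) → count q (filter (λ x → p x ≟ᵇ true) xs) ≡ count (λ x → p x ∧ q x) xs
count-filter p q []       = refl
count-filter p q (x ∷ xs) with p x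
... | false = count-filter p q xs
... | true with q x
...   | true  = cong suc (count-filter p q xs)
...   | false = count-filter p q xs

count-split : (p q : A → Bool) (xs : List A) → count (λ x → p x ∧ q x) xs + count (λ x → p x ∧ not (q x)) xs ≡ count p xs
count-split p q []       = refl
count-split p q (x ∷ xs) with p x | q x
... | false | _     = count-split p q xs
... | true  | true  = cong suc (count-split p q xs)
... | true  | false = trans (+-suc _ _) (cong suc (count-split p q xs))

Any⇒1≤count : {p : A → Bool} {xs : List A} → Any (λ x → p x ≡ true) xs → 1 ≤ count p xs
Any⇒1≤count {p = p} (here {x} px) with p x | px
... | true | _ = s≤s z≤n
Any⇒1≤count {p = p} (there {x} {xs} pxs) =
  ≤-trans (Any⇒1≤count pxs) (≤-trans (m≤n+m _ (𝟙 (p x))) (≤-reflexive (sym (count-∷ p x xs))))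

count-sublists-∷ : (p : List A → Bool) (x : A) (xs : List A) →
  count p (sublists (x ∷ xs)) ≡ count p (sublists xs) + count (p ∘ (x ∷_)) (sublists xs)
count-sublists-∷ p x xs = trans (count-++ p (sublists xs) _) (cong (count p (sublists xs) +_) (count-map p (x ∷_) (sublists xs)))

sum-map-mono : {f g : A → ℕ} → (∀ x → f x ≤ g x) → (xs : List A) → sum (map f xs) ≤ sum (map g xs)
sum-map-mono f≤g []       = z≤n
sum-map-mono f≤g (x ∷ xs) = +-mono-≤ (f≤g x) (sum-map-mono f≤g xs)

sum-map-+ : (f g : A → ℕ) (xs : List A) → sum (map (λ x → f x + g x) xs) ≡ sum (map f xs) + sum (map g xs)
sum-map-+ f g []       = refl
sum-map-+ f g (x ∷ xs) = trans (cong (f x + g x +_) (sum-map-+ f g xs)) (+-interchange (f x) (g x) _ _)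

sum-map-if : (p : A → Bool) (k : ℕ) (xs : List A) → sum (map (λ x → if p x then k else 0) xs) ≡ count p xs * k
sum-map-if p k []       = refl
sum-map-if p k (x ∷ xs) with p x
... | true  = cong (k +_) (sum-map-if p k xs)
... | false = sum-map-if p k xs

==-refl : (a : Fin n) → (a == a) ≡ true
==-refl a = trans (isYes≗does (a ≟ a)) (dec-true (a ≟ a) refl)

==-sym : (a b : Fin n) → (a == b) ≡ (b == a)
==-sym a b with a ≟ b
... | yes refl = sym (==-refl a)
... | no  a≢b  = sym (trans (isYes≗does (b ≟ a)) (dec-false (b ≟ a) (a≢b ∘ sym)))

==⇒≡ : {a b : Fin n} → (a == b) ≡ true → a ≡ b
==⇒≡ {a = a} {b} eq with a ≟ b | eq
... | yes a≡b | _ = a≡b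
... | no  _   | ()

==-suc : (a b : Fin n) → (suc a == suc b) ≡ (a == b)
==-suc a b = trans (isYes≗does (suc a ≟ suc b)) (sym (isYes≗does (a ≟ b)))

not-true : {b : Bool} → not b ≡ true → b ≡ false
not-true {false} _ = refl

nor-true : {p q : Bool} → not (p ∨ q) ≡ true → p ≡ false × q ≡ false
nor-true {false} {false} _ = refl , refl

Edge : ℕ → Set
Edge n = Fin n × Fin n

VSet : ℕ → Set
VSet n = Fin n → Bool

∅ : VSet n
∅ _ = false

touches : Fin n → Edge n → Bool
touches w (a , b) = (w == a) ∨ (w == b)

-- S ⊕ x adds both endpoints of x to S; a single vertex w is added as the loop (w , w).
_⊕_ : VSet n → Edge n → VSet n
(S ⊕ x) z = S z ∨ touches z x

avoids : VSet n → Edge n → Bool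
avoids S (c , d) = not (S c ∨ S d)

joins : Fin n → Fin n → Edge n → Bool
joins u v (a , b) = ((a == u) ∧ (b == v)) ∨ ((a == v) ∧ (b == u))

_⊆_ : VSet n → VSet n → Set
S ⊆ T = ∀ z → S z ≡ true → T z ≡ true

touches-fst : (a b : Fin n) → touches a (a , b) ≡ true
touches-fst a b rewrite ==-refl a = refl

touches-snd : (a b : Fin n) → touches b (a , b) ≡ true
touches-snd a b rewrite ==-refl b = ∨-zeroʳ (b == a)

touches-cases : {z : Fin n} (x : Edge n) → touches z x ≡ true → z ≡ proj₁ x ⊎ z ≡ proj₂ x
touches-cases {z = z} (a , b) t with z == a in za
... | true  = inj₁ (==⇒≡ za)
... | false = inj₂ (==⇒≡ t)

joins-cases : {u v : Fin n} (x : Edge n) → joins u v x ≡ true → x ≡ (u , v) ⊎ x ≡ (v , u)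
joins-cases {u = u} {v} (a , b) j with (a == u) ∧ (b == v) in e
... | true  = inj₁ (cong₂ _,_ (==⇒≡ (∧-conicalˡ _ _ e)) (==⇒≡ (∧-conicalʳ _ _ e)))
... | false = inj₂ (cong₂ _,_ (==⇒≡ (∧-conicalˡ _ _ j)) (==⇒≡ (∧-conicalʳ _ _ j)))

joins-fst : (u v : Fin n) → joins u v (u , v) ≡ true
joins-fst u v rewrite ==-refl u | ==-refl v = refl

joins-snd : (u v : Fin n) → joins u v (v , u) ≡ true
joins-snd u v rewrite ==-refl u | ==-refl v = ∨-zeroʳ _

joins⇒touches : {u v : Fin n} (x : Edge n) → joins u v x ≡ true → (touches u x ∧ touches v x) ≡ true
joins⇒touches {u = u} {v} x j with joins-cases x j
... | inj₁ refl = cong₂ _∧_ (touches-fst u v) (touches-snd u v)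
... | inj₂ refl = cong₂ _∧_ (touches-snd v u) (touches-fst v u)

⊕-endpoint : (S : VSet n) {z : Fin n} (x : Edge n) → touches z x ≡ true → (S ⊕ x) z ≡ true
⊕-endpoint S {z} x t = trans (cong (S z ∨_) t) (∨-zeroʳ (S z))

⊆-⊕ : (S : VSet n) (x : Edge n) → S ⊆ (S ⊕ x)
⊆-⊕ S x z Sz = cong (_∨ touches z x) Sz

⊕-mono : {S T : VSet n} → S ⊆ T → (x : Edge n) → (S ⊕ x) ⊆ (T ⊕ x)
⊕-mono {S = S} {T} S⊆T x z e with S z in Sz
... | true  rewrite S⊆T z Sz = refl
... | false = trans (cong (T z ∨_) e) (∨-zeroʳ (T z))

⊕-comm : (S : VSet n) (x y : Edge n) → ((S ⊕ x) ⊕ y) ⊆ ((S ⊕ y) ⊕ x)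
⊕-comm S x y z e = trans (solve 3 (λ s p q → (s :+ q) :+ p := (s :+ p) :+ q) refl (S z) (touches z x) (touches z y)) e
  where open ∨-∧-Solver

⊆-pair : (T : VSet n) {u v : Fin n} → T u ≡ true → T v ≡ true → (∅ ⊕ (u , v)) ⊆ T
⊆-pair T {u} {v} Tu Tv z t with touches-cases {z = z} (u , v) t
... | inj₁ refl = Tu
... | inj₂ refl = Tv

joins-⊕ : (S : VSet n) {u v : Fin n} {x : Edge n} → joins u v x ≡ true → (S ⊕ x) ⊆ (S ⊕ (u , v))
joins-⊕ S {u} {v} {x} j z e with joins-cases x j
... | inj₁ refl = e
... | inj₂ refl = trans (cong (S z ∨_) (∨-comm (z == u) (z == v))) e

⊆-false : {S T : VSet n} → S ⊆ T → {z : Fin n} → T z ≡ false → S z ≡ false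
⊆-false {S = S} S⊆T {z} Tz with S z in Sz
... | false = refl
... | true with () ← trans (sym (S⊆T z Sz)) Tz

avoids-antitone : {S T : VSet n} → S ⊆ T → (y : Edge n) → avoids T y ≡ true → avoids S y ≡ true
avoids-antitone {T = T} S⊆T (c , d) a with nor-true {T c} {T d} a
... | Tc , Td rewrite ⊆-false S⊆T Tc | ⊆-false S⊆T Td = refl

avoids⇒free : (S : VSet n) {z : Fin n} (y : Edge n) → avoids S y ≡ true → touches z y ≡ true → S z ≡ false
avoids⇒free S {z} (c , d) a t with nor-true {S c} {S d} a | touches-cases {z = z} (c , d) t
... | Sc , _ | inj₁ refl = Sc
... | _ , Sd | inj₂ refl = Sd

avoids⇒¬touches : (S : VSet n) {z : Fin n} (y : Edge n) → S z ≡ true → avoids S y ≡ true → touches z y ≡ false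
avoids⇒¬touches S {z} y Sz a with touches z y in t
... | false = refl
... | true with () ← trans (sym Sz) (avoids⇒free S y a t)

meets-touches : (x : Edge n) (c d : Fin n) → meets x (c , d) ≡ touches c x ∨ touches d x
meets-touches (a , b) c d rewrite ==-sym a c | ==-sym a d | ==-sym b c | ==-sym b d =
  solve 4 (λ ca da cb db → ca :+ (da :+ (cb :+ db)) := (ca :+ cb) :+ (da :+ db)) refl (c == a) (d == a) (c == b) (d == b)
  where open ∨-∧-Solver

meets-sym : (x y : Edge n) → meets x y ≡ meets y x
meets-sym (a , b) (c , d) rewrite ==-sym a c | ==-sym a d | ==-sym b c | ==-sym b d =
  solve 4 (λ ca da cb db → ca :+ (da :+ (cb :+ db)) := ca :+ (cb :+ (da :+ db))) refl (c == a) (d == a) (c == b) (d == b)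
  where open ∨-∧-Solver

avoids-⊕ : (S : VSet n) (x y : Edge n) → avoids (S ⊕ x) y ≡ not (meets x y) ∧ avoids S y
avoids-⊕ S x (c , d) = begin
  not ((S c ∨ touches c x) ∨ (S d ∨ touches d x))
    ≡⟨ cong not (solve 4 (λ sc tc sd td → (sc :+ tc) :+ (sd :+ td) := (tc :+ td) :+ (sc :+ sd))
                        refl (S c) (touches c x) (S d) (touches d x)) ⟩
  not ((touches c x ∨ touches d x) ∨ (S c ∨ S d))
    ≡⟨ deMorgan₂ (touches c x ∨ touches d x) (S c ∨ S d) ⟩
  not (touches c x ∨ touches d x) ∧ not (S c ∨ S d)
    ≡⟨ cong (λ m → not m ∧ not (S c ∨ S d)) (meets-touches x c d) ⟨
  not (meets x (c , d)) ∧ avoids S (c , d) ∎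
  where open ≡-Reasoning
        open ∨-∧-Solver

avoids-⊕⇒disjoint : (S : VSet n) (x y : Edge n) → avoids (S ⊕ x) y ≡ true → meets x y ≡ false
avoids-⊕⇒disjoint S x y a = not-true (∧-conicalˡ (not (meets x y)) (avoids S y) (trans (sym (avoids-⊕ S x y)) a))

avoids-⊕-comm : (S : VSet n) (x y : Edge n) → avoids S x ≡ true → avoids (S ⊕ x) y ≡ true → avoids (S ⊕ y) x ≡ true
avoids-⊕-comm S x y ax axy = begin
  avoids (S ⊕ y) x              ≡⟨ avoids-⊕ S y x ⟩
  not (meets y x) ∧ avoids S x  ≡⟨ cong₂ (λ m b → not m ∧ b) (trans (meets-sym y x) (avoids-⊕⇒disjoint S x y axy)) ax ⟩
  true                          ∎
  where open ≡-Reasoning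

avoids-⊕-vertex : (S : VSet n) (w : Fin n) (x : Edge n) → avoids S x ≡ true → touches w x ≡ false →
  avoids (S ⊕ (w , w)) x ≡ true
avoids-⊕-vertex S w (a , b) ax tw = trans (avoids-⊕ S (w , w) (a , b)) (cong₂ (λ m c → not m ∧ c) meets-ww ax)
  where
  meets-ww : meets (w , w) (a , b) ≡ false
  meets-ww rewrite ∨-conicalˡ (w == a) (w == b) tw | ∨-conicalʳ (w == a) (w == b) tw = refl

⊕-keeps-free : (S : VSet n) (x : Edge n) {u v : Fin n} → avoids (S ⊕ (u , v)) x ≡ true →
  S u ≡ false → S v ≡ false → (S ⊕ x) u ≡ false × (S ⊕ x) v ≡ false
⊕-keeps-free S x {u} {v} a Su Sv =
  cong₂ _∨_ Su (∨-conicalˡ (touches u x) (touches v x) x∩uv) , cong₂ _∨_ Sv (∨-conicalʳ (touches u x) (touches v x) x∩uv)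
  where
  x∩uv : (touches u x ∨ touches v x) ≡ false
  x∩uv = trans (sym (meets-touches x u v)) (trans (meets-sym x (u , v)) (avoids-⊕⇒disjoint S (u , v) x a))

avoids-fst : (T : VSet n) {a b : Fin n} → T a ≡ true → avoids T (a , b) ≡ false
avoids-fst T Ta rewrite Ta = refl

joins⇒¬avoids : (S : VSet n) {u v : Fin n} {x : Edge n} → joins u v x ≡ true → avoids (S ⊕ (u , v)) x ≡ false
joins⇒¬avoids S {u} {v} {x} j with joins-cases x j
... | inj₁ refl = avoids-fst (S ⊕ (u , v)) (⊕-endpoint S (u , v) (touches-fst u v))
... | inj₂ refl = avoids-fst (S ⊕ (u , v)) (⊕-endpoint S (u , v) (touches-snd u v))

joins⇒avoids : {S : VSet n} {u v : Fin n} {x : Edge n} → S u ≡ false → S v ≡ false → joins u v x ≡ true → avoids S x ≡ true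
joins⇒avoids {x = x} Su Sv j with joins-cases x j
... | inj₁ refl rewrite Su | Sv = refl
... | inj₂ refl rewrite Su | Sv = refl

avoids-⊕⇒¬joins : (S : VSet n) {u v : Fin n} (x : Edge n) → avoids (S ⊕ (u , v)) x ≡ true → joins u v x ≡ false
avoids-⊕⇒¬joins S {u} {v} x a with joins u v x in j
... | false = refl
... | true with () ← trans (sym (joins⇒¬avoids S j)) a

all-∧ : (p q : A → Bool) (xs : List A) → all (λ x → p x ∧ q x) xs ≡ all p xs ∧ all q xs
all-∧ p q []       = refl
all-∧ p q (x ∷ xs) = trans (cong ((p x ∧ q x) ∧_) (all-∧ p q xs))
  (solve 4 (λ a b c d → (a :* b) :* (c :* d) := (a :* c) :* (b :* d)) refl (p x) (q x) (all p xs) (all q xs))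
  where open ∨-∧-Solver

isMatchingAvoiding : VSet n → List (Edge n) → Bool
isMatchingAvoiding S m = isMatching m ∧ all (avoids S) m

isMatchingAvoiding-∷ : (S : VSet n) (x : Edge n) (m : List (Edge n)) →
  isMatchingAvoiding S (x ∷ m) ≡ avoids S x ∧ isMatchingAvoiding (S ⊕ x) m
isMatchingAvoiding-∷ S x m = begin
  (disjoint ∧ isMatching m) ∧ (avoids S x ∧ all (avoids S) m)
    ≡⟨ solve 4 (λ a i s b → (a :* i) :* (s :* b) := s :* (i :* (a :* b)))
               refl disjoint (isMatching m) (avoids S x) (all (avoids S) m) ⟩
  avoids S x ∧ isMatching m ∧ disjoint ∧ all (avoids S) m
    ≡⟨ cong (λ b → avoids S x ∧ isMatching m ∧ b) (all-∧ (λ y → not (meets x y)) (avoids S) m) ⟨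
  avoids S x ∧ isMatching m ∧ all (λ y → not (meets x y) ∧ avoids S y) m
    ≡⟨ cong (λ b → avoids S x ∧ isMatching m ∧ b) (cong and (map-cong (avoids-⊕ S x) m)) ⟨
  avoids S x ∧ isMatching m ∧ all (avoids (S ⊕ x)) m ∎
  where
  open ≡-Reasoning
  open ∨-∧-Solver
  disjoint = all (λ y → not (meets x y)) m

all-avoids-∅ : (m : List (Edge n)) → all (avoids ∅) m ≡ true
all-avoids-∅ []      = refl
all-avoids-∅ (_ ∷ m) = all-avoids-∅ m

isMatchingAvoiding-∅ : (m : List (Edge n)) → isMatchingAvoiding ∅ m ≡ isMatching m
isMatchingAvoiding-∅ m = trans (cong (isMatching m ∧_) (all-avoids-∅ m)) (∧-identityʳ (isMatching m))

#matchings : List (Edge n) → VSet n → ℕ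
#matchings []       S = 1
#matchings (x ∷ xs) S = #matchings xs S + (if avoids S x then #matchings xs (S ⊕ x) else 0)

#matchingsThrough : Fin n → Fin n → List (Edge n) → VSet n → ℕ
#matchingsThrough u v []       S = 0
#matchingsThrough u v (x ∷ xs) S = #matchingsThrough u v xs S +
  (if avoids S x then (if joins u v x then #matchings xs (S ⊕ x) else #matchingsThrough u v xs (S ⊕ x)) else 0)

count-isMatchingAvoiding : (E : List (Edge n)) (S : VSet n) → count (isMatchingAvoiding S) (sublists E) ≡ #matchings E S
count-isMatchingAvoiding []       S = refl
count-isMatchingAvoiding (x ∷ xs) S = begin
  count (isMatchingAvoiding S) (sublists (x ∷ xs))
    ≡⟨ count-sublists-∷ (isMatchingAvoiding S) x xs ⟩
  count (isMatchingAvoiding S) (sublists xs) + count (isMatchingAvoiding S ∘ (x ∷_)) (sublists xs)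
    ≡⟨ cong₂ _+_ (count-isMatchingAvoiding xs S) (count-cong (isMatchingAvoiding-∷ S x) (sublists xs)) ⟩
  #matchings xs S + count (λ m → avoids S x ∧ isMatchingAvoiding (S ⊕ x) m) (sublists xs)
    ≡⟨ cong (#matchings xs S +_) (count-∧ˡ (avoids S x) _ (sublists xs)) ⟩
  #matchings xs S + (if avoids S x then count (isMatchingAvoiding (S ⊕ x)) (sublists xs) else 0)
    ≡⟨ cong (λ k → #matchings xs S + (if avoids S x then k else 0)) (count-isMatchingAvoiding xs (S ⊕ x)) ⟩
  #matchings (x ∷ xs) S ∎
  where open ≡-Reasoning

count-containsEdge : (u v : Fin n) (E : List (Edge n)) (S : VSet n) →
  count (λ m → isMatchingAvoiding S m ∧ containsEdge u v m) (sublists E) ≡ #matchingsThrough u v E S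
count-containsEdge u v []       S = refl
count-containsEdge {n = n} u v (x ∷ xs) S = begin
  count (through S) (sublists (x ∷ xs))
    ≡⟨ count-sublists-∷ (through S) x xs ⟩
  count (through S) (sublists xs) + count (through S ∘ (x ∷_)) (sublists xs)
    ≡⟨ cong₂ _+_ (count-containsEdge u v xs S) (count-cong through-∷ (sublists xs)) ⟩
  #matchingsThrough u v xs S + count (λ m → avoids S x ∧ after-x (joins u v x) m) (sublists xs)
    ≡⟨ cong (#matchingsThrough u v xs S +_) (count-∧ˡ (avoids S x) (after-x (joins u v x)) (sublists xs)) ⟩
  #matchingsThrough u v xs S + (if avoids S x then count (after-x (joins u v x)) (sublists xs) else 0)
    ≡⟨ cong (λ k → #matchingsThrough u v xs S + (if avoids S x then k else 0)) (count-after-x (joins u v x)) ⟩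
  #matchingsThrough u v (x ∷ xs) S ∎
  where
  open ≡-Reasoning
  through : VSet n → List (Edge n) → Bool
  through T m = isMatchingAvoiding T m ∧ containsEdge u v m
  after-x : Bool → List (Edge n) → Bool
  after-x b m = isMatchingAvoiding (S ⊕ x) m ∧ (b ∨ containsEdge u v m)
  through-∷ : (m : List (Edge n)) → through S (x ∷ m) ≡ avoids S x ∧ after-x (joins u v x) m
  through-∷ m = trans (cong (_∧ containsEdge u v (x ∷ m)) (isMatchingAvoiding-∷ S x m))
                   (∧-assoc (avoids S x) (isMatchingAvoiding (S ⊕ x) m) (containsEdge u v (x ∷ m)))
  count-after-x : (b : Bool) → count (after-x b) (sublists xs)
                             ≡ (if b then #matchings xs (S ⊕ x) else #matchingsThrough u v xs (S ⊕ x))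
  count-after-x true  = trans (count-cong (λ m → ∧-identityʳ _) (sublists xs)) (count-isMatchingAvoiding xs (S ⊕ x))
  count-after-x false = count-containsEdge u v xs (S ⊕ x)

length-matchings : (G : Graph n) → length (matchings G) ≡ #matchings (edges G) ∅
length-matchings G =
  trans (sym (count-cong isMatchingAvoiding-∅ (sublists (edges G)))) (count-isMatchingAvoiding (edges G) ∅)

count-containsEdge-matchings : (G : Graph n) (u v : Fin n) →
  count (containsEdge u v) (matchings G) ≡ #matchingsThrough u v (edges G) ∅
count-containsEdge-matchings G u v = begin
  count (containsEdge u v) (matchings G)
    ≡⟨ count-filter isMatching (containsEdge u v) (sublists (edges G)) ⟩
  count (λ m → isMatching m ∧ containsEdge u v m) (sublists (edges G))
    ≡⟨ count-cong (λ m → cong (_∧ containsEdge u v m) (isMatchingAvoiding-∅ m)) (sublists (edges G)) ⟨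
  count (λ m → isMatchingAvoiding ∅ m ∧ containsEdge u v m) (sublists (edges G))
    ≡⟨ count-containsEdge u v (edges G) ∅ ⟩
  #matchingsThrough u v (edges G) ∅ ∎
  where open ≡-Reasoning

#matchings-antitone : {S T : VSet n} → S ⊆ T → (E : List (Edge n)) → #matchings E T ≤ #matchings E S
#matchings-antitone S⊆T []       = ≤-refl
#matchings-antitone {S = S} {T} S⊆T (x ∷ xs) with avoids T x in Tx
... | false = ≤-trans (≤-reflexive (+-identityʳ _)) (≤-trans (#matchings-antitone S⊆T xs) (m≤m+n _ _))
... | true rewrite avoids-antitone S⊆T x Tx =
  +-mono-≤ (#matchings-antitone S⊆T xs) (#matchings-antitone (⊕-mono S⊆T x) xs)

#matchings-∷ : (x : Edge n) (xs : List (Edge n)) (S : VSet n) → #matchings xs S ≤ #matchings (x ∷ xs) S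
#matchings-∷ x xs S = m≤m+n _ _

#matchings-≤-#matchingsThrough : {u v : Fin n} {S : VSet n} {E : List (Edge n)} → S u ≡ false → S v ≡ false →
  Any (λ x → joins u v x ≡ true) E → #matchings E (S ⊕ (u , v)) ≤ #matchingsThrough u v E S
#matchings-≤-#matchingsThrough {u = u} {v} {S} Su Sv (here {x} {xs} j) = begin
  #matchings xs (S ⊕ (u , v)) + (if avoids (S ⊕ (u , v)) x then #matchings xs ((S ⊕ (u , v)) ⊕ x) else 0)
    ≡⟨ cong (λ b → #matchings xs (S ⊕ (u , v)) + (if b then #matchings xs ((S ⊕ (u , v)) ⊕ x) else 0))
            (joins⇒¬avoids S j) ⟩
  #matchings xs (S ⊕ (u , v)) + 0
    ≡⟨ +-identityʳ _ ⟩
  #matchings xs (S ⊕ (u , v))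
    ≤⟨ #matchings-antitone (joins-⊕ S j) xs ⟩
  #matchings xs (S ⊕ x)
    ≡⟨ cong₂ (λ a b → if a then (if b then #matchings xs (S ⊕ x) else #matchingsThrough u v xs (S ⊕ x)) else 0)
             (joins⇒avoids {S = S} Su Sv j) j ⟨
  (if avoids S x then (if joins u v x then #matchings xs (S ⊕ x) else #matchingsThrough u v xs (S ⊕ x)) else 0)
    ≤⟨ m≤n+m _ _ ⟩
  #matchingsThrough u v (x ∷ xs) S ∎
  where open ≤-Reasoning
#matchings-≤-#matchingsThrough {u = u} {v} {S} Su Sv (there {x} {xs} uv∈xs) =
  +-mono-≤ (#matchings-≤-#matchingsThrough Su Sv uv∈xs) x-branch
  where
  x-branch : (if avoids (S ⊕ (u , v)) x then #matchings xs ((S ⊕ (u , v)) ⊕ x) else 0)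
           ≤ (if avoids S x then (if joins u v x then #matchings xs (S ⊕ x) else #matchingsThrough u v xs (S ⊕ x)) else 0)
  x-branch with avoids (S ⊕ (u , v)) x in a
  ... | false = z≤n
  ... | true with ⊕-keeps-free S x a Su Sv
  ...   | Sxu , Sxv rewrite avoids-antitone (⊆-⊕ S (u , v)) x a | avoids-⊕⇒¬joins S x a =
    ≤-trans (#matchings-antitone (⊕-comm S x (u , v)) xs) (#matchings-≤-#matchingsThrough Sxu Sxv uv∈xs)

branch : Fin n → List (Edge n) → VSet n → Edge n → ℕ
branch w E S y = if touches w y ∧ avoids S y then #matchings E (S ⊕ y) else 0

branch-∷ : (w : Fin n) (x : Edge n) (xs : List (Edge n)) (S : VSet n) (y : Edge n) → branch w xs S y ≤ branch w (x ∷ xs) S y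
branch-∷ w x xs S y with touches w y ∧ avoids S y
... | true  = #matchings-∷ x xs (S ⊕ y)
... | false = z≤n

branch-merge : (w : Fin n) (x : Edge n) (xs : List (Edge n)) (S : VSet n) → avoids S x ≡ true →
  (y : Edge n) → branch w xs S y + branch w xs (S ⊕ x) y ≤ branch w (x ∷ xs) S y
branch-merge w x xs S ax y with touches w y
... | false = z≤n
... | true with avoids (S ⊕ x) y in axy
...   | true rewrite avoids-antitone (⊆-⊕ S x) y axy | avoids-⊕-comm S x y ax axy =
  +-monoʳ-≤ (#matchings xs (S ⊕ y)) (#matchings-antitone (⊕-comm S y x) xs)
...   | false with avoids S y
...     | true  = ≤-trans (≤-reflexive (+-identityʳ _)) (#matchings-∷ x xs (S ⊕ y))
...     | false = z≤n

-- A matching avoiding S either misses w or uses exactly one edge y at w, and without y it avoids S ⊕ y.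
#matchings-decompose : (w : Fin n) (E : List (Edge n)) (S : VSet n) →
  #matchings E S ≤ #matchings E (S ⊕ (w , w)) + sum (map (branch w E S) E)

#matchings-decompose-∷ : (w : Fin n) (x : Edge n) (xs : List (Edge n)) (S : VSet n) →
  #matchings xs S ≤ #matchings (x ∷ xs) (S ⊕ (w , w)) + sum (map (branch w (x ∷ xs) S) xs)
#matchings-decompose-∷ w x xs S =
  ≤-trans (#matchings-decompose w xs S) (+-mono-≤ (#matchings-∷ x xs _) (sum-map-mono (branch-∷ w x xs S) xs))

#matchings-decompose w []       S = s≤s z≤n
#matchings-decompose {n = n} w (x ∷ xs) S with avoids S x in ax
... | false = ≤-trans (≤-reflexive (+-identityʳ _))
                (≤-trans (#matchings-decompose-∷ w x xs S) (+-monoʳ-≤ (#matchings (x ∷ xs) (S ⊕ (w , w))) (m≤n+m _ _)))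
... | true with touches w x in wx
...   | true = begin
  #matchings xs S + #matchings xs (S ⊕ x)
    ≤⟨ +-mono-≤ (#matchings-decompose-∷ w x xs S) (#matchings-∷ x xs (S ⊕ x)) ⟩
  (#matchings (x ∷ xs) (S ⊕ (w , w)) + rest) + #matchings (x ∷ xs) (S ⊕ x)
    ≡⟨ +-assoc (#matchings (x ∷ xs) (S ⊕ (w , w))) rest _ ⟩
  #matchings (x ∷ xs) (S ⊕ (w , w)) + (rest + #matchings (x ∷ xs) (S ⊕ x))
    ≡⟨ cong (#matchings (x ∷ xs) (S ⊕ (w , w)) +_) (+-comm rest _) ⟩
  #matchings (x ∷ xs) (S ⊕ (w , w)) + (#matchings (x ∷ xs) (S ⊕ x) + rest) ∎
  where
  open ≤-Reasoning
  rest : ℕ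
  rest = sum (map (branch w (x ∷ xs) S) xs)
...   | false rewrite avoids-⊕-vertex S w x ax wx = begin
  #matchings xs S + #matchings xs (S ⊕ x)
    ≤⟨ +-mono-≤ (#matchings-decompose w xs S) (#matchings-decompose w xs (S ⊕ x)) ⟩
  (#matchings xs (S ⊕ (w , w)) + branches S) + (#matchings xs ((S ⊕ x) ⊕ (w , w)) + branches (S ⊕ x))
    ≡⟨ +-interchange (#matchings xs (S ⊕ (w , w))) _ _ _ ⟩
  missing-w + (branches S + branches (S ⊕ x))
    ≡⟨ cong (missing-w +_) (sum-map-+ (branch w xs S) (branch w xs (S ⊕ x)) xs) ⟨
  missing-w + sum (map (λ y → branch w xs S y + branch w xs (S ⊕ x) y) xs)
    ≤⟨ +-mono-≤ (+-monoʳ-≤ _ (#matchings-antitone (⊕-comm S (w , w) x) xs)) (sum-map-mono (branch-merge w x xs S ax) xs) ⟩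
  (#matchings xs (S ⊕ (w , w)) + #matchings xs ((S ⊕ (w , w)) ⊕ x)) + sum (map (branch w (x ∷ xs) S) xs) ∎
  where
  open ≤-Reasoning
  branches : VSet n → ℕ
  branches T = sum (map (branch w xs T) xs)
  missing-w : ℕ
  missing-w = #matchings xs (S ⊕ (w , w)) + #matchings xs ((S ⊕ x) ⊕ (w , w))

≤-square : ∀ {a b s d} → suc b ≤ d → suc a + s ≤ d → suc a * suc b + s ≤ d * d
≤-square {d = zero} () _
≤-square {a} {b} {s} {suc d} 1+b≤d 1+a+s≤d = begin
  suc a * suc b + s          ≤⟨ +-mono-≤ (*-monoʳ-≤ (suc a) 1+b≤d) (m≤m*n s (suc d)) ⟩
  suc a * suc d + s * suc d  ≡⟨ *-distribʳ-+ (suc d) (suc a) s ⟨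
  (suc a + s) * suc d        ≤⟨ *-monoˡ-≤ (suc d) 1+a+s≤d ⟩
  suc d * suc d              ∎
  where open ≤-Reasoning

≤-square+1 : ∀ {a b t d} → 1 ≤ t → a + t ≤ d → b + t ≤ d → suc a * suc b + t ≤ d * d + 1
≤-square+1 {a} {b} {suc s} {d} _ a+t≤d b+t≤d = begin
  suc a * suc b + suc s    ≡⟨ +-suc _ s ⟩
  suc (suc a * suc b + s)  ≤⟨ s≤s (≤-square 1+b≤d 1+a+s≤d) ⟩
  suc (d * d)              ≡⟨ +-comm 1 (d * d) ⟩
  d * d + 1                ∎
  where
  open ≤-Reasoning
  1+b≤d : suc b ≤ d
  1+b≤d = ≤-trans (s≤s (m≤m+n b s)) (≤-trans (≤-reflexive (sym (+-suc b s))) b+t≤d)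
  1+a+s≤d : suc a + s ≤ d
  1+a+s≤d = ≤-trans (≤-reflexive (sym (+-suc a s))) a+t≤d

bound-factorises : ∀ a b t k → (k + b * k) + (t * k + a * (k + b * k)) ≡ (suc a * suc b + t) * k
bound-factorises = solve-∀

module _ (E : List (Edge n)) (u v : Fin n) where

  private
    K onlyU onlyV both : ℕ
    K     = #matchings E (∅ ⊕ (u , v))
    onlyU = count (λ y → touches u y ∧ not (touches v y)) E
    onlyV = count (λ y → touches v y ∧ not (touches u y)) E
    both  = count (λ y → touches u y ∧ touches v y) E

  #matchings-covering-u : (S : VSet n) → S u ≡ true → #matchings E S ≤ K + onlyV * K
  #matchings-covering-u S Su = begin
    #matchings E S
      ≤⟨ #matchings-decompose v E S ⟩
    #matchings E (S ⊕ (v , v)) + sum (map (branch v E S) E)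
      ≤⟨ +-mono-≤ (#matchings-antitone (⊆-pair (S ⊕ (v , v)) (cong (_∨ _) Su) (⊕-endpoint S (v , v) (touches-fst v v))) E)
                  (sum-map-mono branch≤ E) ⟩
    K + sum (map (λ y → if touches v y ∧ not (touches u y) then K else 0) E)
      ≡⟨ cong (K +_) (sum-map-if _ K E) ⟩
    K + onlyV * K ∎
    where
    open ≤-Reasoning
    branch≤ : (y : Edge n) → branch v E S y ≤ (if touches v y ∧ not (touches u y) then K else 0)
    branch≤ y with touches v y in vy | avoids S y in ay
    ... | false | _    = z≤n
    ... | true  | false = z≤n
    ... | true  | true rewrite avoids⇒¬touches S y Su ay =
      #matchings-antitone (⊆-pair (S ⊕ y) (cong (_∨ _) Su) (⊕-endpoint S y vy)) E

  #matchings-∅-≤ : ∀ {d} → 1 ≤ both → count (touches u) E ≤ d → count (touches v) E ≤ d →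
    #matchings E ∅ ≤ (d * d + 1) * K
  #matchings-∅-≤ {d} 1≤both deg-u deg-v = begin
    #matchings E ∅
      ≤⟨ #matchings-decompose u E ∅ ⟩
    #matchings E (∅ ⊕ (u , u)) + sum (map (branch u E ∅) E)
      ≤⟨ +-mono-≤ (#matchings-covering-u (∅ ⊕ (u , u)) (touches-fst u u)) (sum-map-mono branch≤ E) ⟩
    (K + onlyV * K) + sum (map (λ y → (if touches u y ∧ touches v y then K else 0)
                                     + (if touches u y ∧ not (touches v y) then K + onlyV * K else 0)) E)
      ≡⟨ cong ((K + onlyV * K) +_) (trans (sum-map-+ _ _ E) (cong₂ _+_ (sum-map-if _ K E) (sum-map-if _ (K + onlyV * K) E))) ⟩
    (K + onlyV * K) + (both * K + onlyU * (K + onlyV * K))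
      ≡⟨ bound-factorises onlyU onlyV both K ⟩
    (suc onlyU * suc onlyV + both) * K
      ≤⟨ *-monoˡ-≤ K (≤-square+1 1≤both onlyU+both≤d onlyV+both≤d) ⟩
    (d * d + 1) * K ∎
    where
    open ≤-Reasoning
    branch≤ : (y : Edge n) → branch u E ∅ y ≤ (if touches u y ∧ touches v y then K else 0)
                                                + (if touches u y ∧ not (touches v y) then K + onlyV * K else 0)
    branch≤ y with touches u y in uy | touches v y in vy
    ... | false | _     = z≤n
    ... | true  | true  = ≤-trans (#matchings-antitone (⊆-pair (∅ ⊕ y) uy vy) E) (m≤m+n K 0)
    ... | true  | false = #matchings-covering-u (∅ ⊕ y) uy
    onlyU+both≤d : onlyU + both ≤ d
    onlyU+both≤d = ≤-trans (≤-reflexive (trans (+-comm onlyU both) (count-split (touches u) (touches v) E))) deg-u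
    onlyV+both≤d : onlyV + both ≤ d
    onlyV+both≤d = ≤-trans (≤-reflexive (trans (+-comm onlyV both)
                     (trans (cong (_+ onlyV) (count-cong (λ y → ∧-comm (touches u y) (touches v y)) E))
                            (count-split (touches v) (touches u) E)))) deg-v

≤-foldr-⊔ : {m : ℕ} {ms : List ℕ} → m ∈ ms → m ≤ foldr _⊔_ 0 ms
≤-foldr-⊔ (here refl)            = m≤m⊔n _ _
≤-foldr-⊔ {ms = k ∷ _} (there p) = ≤-trans (≤-foldr-⊔ p) (m≤n⊔m k _)

∑-mono-≤ : {f g : Fin n → ℕ} → (∀ i → f i ≤ g i) → ∑[ i < n ] f i ≤ ∑[ i < n ] g i
∑-mono-≤ {n = zero}  f≤g = z≤n
∑-mono-≤ {n = suc n} f≤g = +-mono-≤ (f≤g zero) (∑-mono-≤ (f≤g ∘ suc))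

∑-indicator : (w : Fin n) (g : Fin n → ℕ) → ∑[ a < n ] (if w == a then g a else 0) ≡ g w
∑-indicator {n = suc n} zero    g = trans (cong (g zero +_) (sum-replicate-zero n)) (+-identityʳ (g zero))
∑-indicator {n = suc n} (suc w) g =
  trans (sum-cong-≗ (λ a → cong (λ b → if b then g (suc a) else 0) (==-suc w a))) (∑-indicator w (g ∘ suc))

count-tabulate : (p : A → Bool) (g : Fin n → A) → count p (tabulate g) ≡ ∑[ a < n ] 𝟙 (p (g a))
count-tabulate {n = zero}  p g = refl
count-tabulate {n = suc n} p g = trans (count-∷ p (g zero) _) (cong (𝟙 (p (g zero)) +_) (count-tabulate p (g ∘ suc)))

count-concatMap-tabulate : (p : B → Bool) (f : A → List B) (g : Fin n → A) →
  count p (concatMap f (tabulate g)) ≡ ∑[ a < n ] count p (f (g a))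
count-concatMap-tabulate {n = zero}  p f g = refl
count-concatMap-tabulate {n = suc n} p f g =
  trans (count-++ p (f (g zero)) _) (cong (count p (f (g zero)) +_) (count-concatMap-tabulate p f (g ∘ suc)))

count-if-singleton : (q : A → Bool) (c : Bool) (x : A) → count q (if c then x ∷ [] else []) ≡ 𝟙 (c ∧ q x)
count-if-singleton q false x = refl
count-if-singleton q true  x = trans (count-∷ q x []) (+-identityʳ (𝟙 (q x)))

𝟙-∧-∨ : ∀ c p q → 𝟙 (c ∧ (p ∨ q)) ≤ (if p then 𝟙 c else 0) + (if q then 𝟙 c else 0)
𝟙-∧-∨ false p     q     = z≤n
𝟙-∧-∨ true  true  q     = s≤s z≤n
𝟙-∧-∨ true  false true  = s≤s z≤n
𝟙-∧-∨ true  false false = z≤n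

<ᵇ≡true⇒< : ∀ {i j} → (i <ᵇ j) ≡ true → i < j
<ᵇ≡true⇒< {i} {j} i<ᵇj = <ᵇ⇒< i j (Equivalence.from T-≡ i<ᵇj)

<⇒<ᵇ≡true : ∀ {i j} → i < j → (i <ᵇ j) ≡ true
<⇒<ᵇ≡true i<j = Equivalence.to T-≡ (<⇒<ᵇ i<j)

𝟙-<ᵇ-either : (i j : ℕ) (e : Bool) → 𝟙 ((i <ᵇ j) ∧ e) + 𝟙 ((j <ᵇ i) ∧ e) ≤ 𝟙 e
𝟙-<ᵇ-either i j e with i <ᵇ j in i<j | j <ᵇ i in j<i
... | true  | true  with () ← <-asym (<ᵇ≡true⇒< {i} {j} i<j) (<ᵇ≡true⇒< {j} {i} j<i)
... | true  | false = ≤-reflexive (+-identityʳ (𝟙 e))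
... | false | true  = ≤-refl
... | false | false = z≤n

module _ (G : Graph n) where

  private
    ordered : Fin n → Fin n → Bool
    ordered a b = (toℕ a <ᵇ toℕ b) ∧ adj G a b

  count-edges : (q : Edge n → Bool) → count q (edges G) ≡ ∑[ a < n ] ∑[ b < n ] 𝟙 (ordered a b ∧ q (a , b))
  count-edges q = trans (count-concatMap-tabulate q row id) (sum-cong-≗ λ a →
    trans (count-concatMap-tabulate q (entry a) id) (sum-cong-≗ λ b → count-if-singleton q (ordered a b) (a , b)))
    where
    entry : Fin n → Fin n → List (Edge n)
    entry a b = if ordered a b then (a , b) ∷ [] else []
    row : Fin n → List (Edge n)
    row a = concatMap (entry a) (allFin n)

  count-touches≤degree : (w : Fin n) → count (touches w) (edges G) ≤ degree G w
  count-touches≤degree w = begin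
    count (touches w) (edges G)
      ≡⟨ count-edges (touches w) ⟩
    ∑[ a < n ] ∑[ b < n ] 𝟙 (ordered a b ∧ ((w == a) ∨ (w == b)))
      ≤⟨ ∑-mono-≤ (λ a → ∑-mono-≤ (λ b → 𝟙-∧-∨ (ordered a b) (w == a) (w == b))) ⟩
    ∑[ a < n ] ∑[ b < n ] (w-first a b + w-second a b)
      ≡⟨ trans (sum-cong-≗ (λ a → ∑-distrib-+ (w-first a) (w-second a)))
               (∑-distrib-+ (λ a → ∑[ b < n ] w-first a b) (λ a → ∑[ b < n ] w-second a b)) ⟩
    ∑[ a < n ] ∑[ b < n ] w-first a b + ∑[ a < n ] ∑[ b < n ] w-second a b
      ≡⟨ cong₂ _+_ (trans (∑-comm w-first) (sum-cong-≗ λ b → ∑-indicator w (λ a → 𝟙 (ordered a b))))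
                   (sum-cong-≗ λ a → ∑-indicator w (λ b → 𝟙 (ordered a b))) ⟩
    ∑[ b < n ] 𝟙 (ordered w b) + ∑[ a < n ] 𝟙 (ordered a w)
      ≡⟨ ∑-distrib-+ (λ b → 𝟙 (ordered w b)) (λ b → 𝟙 (ordered b w)) ⟨
    ∑[ b < n ] (𝟙 (ordered w b) + 𝟙 (ordered b w))
      ≤⟨ ∑-mono-≤ one-orientation ⟩
    ∑[ b < n ] 𝟙 (adj G w b)
      ≡⟨ count-tabulate (adj G w) id ⟨
    degree G w ∎
    where
    open ≤-Reasoning
    w-first w-second : Fin n → Fin n → ℕ
    w-first a b = if w == a then 𝟙 (ordered a b) else 0
    w-second a b = if w == b then 𝟙 (ordered a b) else 0
    one-orientation : (b : Fin n) → 𝟙 (ordered w b) + 𝟙 (ordered b w) ≤ 𝟙 (adj G w b)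
    one-orientation b rewrite Graph.sym G b w = 𝟙-<ᵇ-either (toℕ w) (toℕ b) (adj G w b)

  degree≤maxDegree : (w : Fin n) → degree G w ≤ maxDegree G
  degree≤maxDegree w = ≤-foldr-⊔ (∈-map⁺ (degree G) (∈-allFin w))

  Any-edges : {P : Edge n → Set} {a b : Fin n} → ordered a b ≡ true → P (a , b) → Any P (edges G)
  Any-edges {P} {a} {b} ab p =
    concatMap⁺ _ (tabulate⁺ a (concatMap⁺ _ (tabulate⁺ b
      (subst (λ c → Any P (if c then (a , b) ∷ [] else [])) (sym ab) (here p)))))

  joins-Any-edges : {u v : Fin n} → adj G u v ≡ true → Any (λ x → joins u v x ≡ true) (edges G)
  joins-Any-edges {u} {v} uv with <-cmp (toℕ u) (toℕ v)
  ... | tri< u<v _ _ = Any-edges (cong₂ _∧_ (<⇒<ᵇ≡true u<v) uv) (joins-fst u v)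
  ... | tri> _ _ v<u = Any-edges (cong₂ _∧_ (<⇒<ᵇ≡true v<u) (trans (Graph.sym G v u) uv)) (joins-snd u v)
  ... | tri≈ _ u≡v _ with toℕ-injective u≡v
  ...   | refl with () ← trans (sym uv) (Graph.irrefl G u)

proposition6p4 : (n : ℕ) (G : Graph n) (d : ℕ) → maxDegree G ≡ d →
    (u v : Fin n) → adj G u v ≡ true →
    length (matchings G) ≤ (d * d + 1) * length (filter (λ M → containsEdge u v M ≟ᵇ true) (matchings G))
proposition6p4 n G d refl u v uv = begin
  length (matchings G)
    ≡⟨ length-matchings G ⟩
  #matchings E ∅
    ≤⟨ #matchings-∅-≤ E u v (≤-trans (Any⇒1≤count uv∈E) (count-mono joins⇒touches E))
                            (≤-maxDegree u) (≤-maxDegree v) ⟩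
  (d * d + 1) * #matchings E (∅ ⊕ (u , v))
    ≤⟨ *-monoʳ-≤ (d * d + 1) (#matchings-≤-#matchingsThrough refl refl uv∈E) ⟩
  (d * d + 1) * #matchingsThrough u v E ∅
    ≡⟨ cong ((d * d + 1) *_) (count-containsEdge-matchings G u v) ⟨
  (d * d + 1) * count (containsEdge u v) (matchings G) ∎
  where
  open ≤-Reasoning
  E : List (Edge n)
  E = edges G
  uv∈E : Any (λ x → joins u v x ≡ true) E
  uv∈E = joins-Any-edges G uv
  ≤-maxDegree : (w : Fin n) → count (touches w) E ≤ maxDegree G
  ≤-maxDegree w = ≤-trans (count-touches≤degree G w) (degree≤maxDegree G w)
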